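{- For every finite graph $G$, $\{C\in\mathfrak{M}(G):|C|\geq 2\}=\mathcal{C}(G)\cup\mathcal{S}(G)\cup\mathcal{P}(G)$.
   Context: Graphs are finite, simple, undirected. A module of $G$ is a set $M\subseteq V(G)$ such that each vertex outside $M$ is adjacent to all or none of $M$; trivial modules are $\emptyset$, $V(G)$, singletons; $G$ is prime if $|V(G)|\ge 4$ and all modules are trivial. $\mathcal{M}(G)$ is the family of modules of $G$ of cardinality at least $2$ and $\mathcal{M}_{\min}(G)$ its minimal elements under inclusion. $\mathcal{P}(G)$ is the family of modules $M$ with $G[M]$ prime. $\mathcal{C}(G)$ (resp. $\mathcal{S}(G)$) is the family of maximal elements under inclusion among the elements of $\mathcal{M}(G)$ that are cliques (resp. stable sets) in $G$. The relation $\approx_G$ on $V(G)$: $u\approx_G v$ iff $u=v$ or there is $M\in\mathcal{M}_{\min}(G)$ with $u,v\in M$; it is an equivalence relation, and $\mathfrak{M}(G)$ is its set of equivalence classes. -}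

module Defs where

open import Data.Nat using (ℕ; _≤_; _≡ᵇ_)
open import Data.Bool using (Bool; true; false)
open import Data.Fin using (Fin)
open import Data.Fin.Subset using (Subset; _∈_; _∉_; _⊆_; ∣_∣; ⊥; ⊤)
open import Data.Product using (Σ; _×_; ∃)
open import Data.Sum using (_⊎_)
open import Relation.Binary.PropositionalEquality using (_≡_; _≢_)

record Graph (n : ℕ) : Set where
  field
    adj    : Fin n → Fin n → Bool
    sym    : ∀ u v → adj u v ≡ adj v u
    irrefl : ∀ u → adj u u ≡ false
open Graph public

module _ {n : ℕ} (G : Graph n) where

  IsModuleIn : Subset n → Subset n → Set
  IsModuleIn W N = N ⊆ W × (∀ x → x ∈ W → x ∉ N →
                     ∀ u v → u ∈ N → v ∈ N → adj G x u ≡ adj G x v)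

  IsModule : Subset n → Set
  IsModule M = IsModuleIn ⊤ M

  TrivialIn : Subset n → Subset n → Set
  TrivialIn W N = N ≡ ⊥ ⊎ N ≡ W ⊎ ∣ N ∣ ≡ 1

  PrimeOn : Subset n → Set
  PrimeOn W = 4 ≤ ∣ W ∣ × (∀ N → IsModuleIn W N → TrivialIn W N)

  Prime : Set
  Prime = PrimeOn ⊤

  InM : Subset n → Set
  InM M = IsModule M × 2 ≤ ∣ M ∣

  InMmin : Subset n → Set
  InMmin M = InM M × (∀ M' → InM M' → M' ⊆ M → M' ≡ M)

  InP : Subset n → Set
  InP M = IsModule M × PrimeOn M

  IsClique : Subset n → Set
  IsClique M = ∀ u v → u ∈ M → v ∈ M → u ≢ v → adj G u v ≡ true

  IsStable : Subset n → Set
  IsStable M = ∀ u v → u ∈ M → v ∈ M → adj G u v ≡ false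

  InC : Subset n → Set
  InC M = (InM M × IsClique M) ×
          (∀ M' → InM M' → IsClique M' → M ⊆ M' → M' ≡ M)

  InS : Subset n → Set
  InS M = (InM M × IsStable M) ×
          (∀ M' → InM M' → IsStable M' → M ⊆ M' → M' ≡ M)

  Approx : Fin n → Fin n → Set
  Approx u v = u ≡ v ⊎ Σ (Subset n) (λ M → InMmin M × u ∈ M × v ∈ M)

  InFrakM : Subset n → Set
  InFrakM C = ∃ λ u → ∀ v → (v ∈ C → Approx u v) × (Approx u v → v ∈ C)

-- Two minimal modules M, M' through a vertex u coincide unless |M| = 2: if they differed but
-- shared a second vertex, M ∩ M' would be a smaller member of 𝓜(G); if they met only in u and
-- |M| ≥ 3, M ─ M' would be one. No minimal module has three vertices (of any three vertices
-- one sees the other two alike, and these two form a module), so a minimal module with more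
-- than two vertices is prime; conversely prime modules are minimal. Hence the ≈-class of u
-- is either the unique minimal module through u, when it is prime, or the set of twins of u
-- (vertices that no third vertex distinguishes from u). Such a twin class is a module on
-- which all edges agree and is maximal with this property, i.e. lies in 𝒞(G) or 𝒮(G); and
-- every member of 𝒞(G) ∪ 𝒮(G) is the twin class of each of its vertices.

module Submission where

open import Defs hiding (sym)
open import Data.Bool using (Bool; true; false)
open import Data.Bool.Properties using () renaming (_≟_ to _≟ᵇ_)
open import Data.Empty using (⊥-elim)
open import Data.Fin using (Fin)
open import Data.Fin.Properties using (_≟_; any?; all?)
open import Data.Fin.Subset
open import Data.Fin.Subset.Properties
open import Data.Nat using (ℕ; suc; _≤_; _<_; z≤n; s≤s; s≤s⁻¹) renaming (_≟_ to _≟ℕ_)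
open import Data.Nat.Properties using (≤-trans; ≤-reflexive; ≤∧≢⇒<; <⇒≱; <-irrefl)
open import Data.Product using (∃; _×_; _,_; proj₁; proj₂)
open import Data.Sum using (_⊎_; inj₁; inj₂; [_,_])
open import Data.Vec using (_∷_; here; there; tabulate)
open import Data.Vec.Properties using (lookup∘tabulate; []=⇒lookup; lookup⇒[]=)
open import Function using (_∘_)
open import Relation.Nullary using (Dec; yes; no; ¬?; does; contradiction)
open import Relation.Nullary.Decidable
  using (_×-dec_; _→-dec_; decidable-stable; dec-true; dec-false)
open import Relation.Binary.PropositionalEquality
  using (_≡_; _≢_; refl; sym; trans; cong; subst; module ≡-Reasoning)

private variable
  n k : ℕ
  p q : Subset n
  x y z : Fin n

x∈p⇒∣p∣≡suc∣p-x∣ : x ∈ p → ∣ p ∣ ≡ suc ∣ p - x ∣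
x∈p⇒∣p∣≡suc∣p-x∣ {p = inside  ∷ p} here        = cong suc (sym (cong ∣_∣ (p─⊥≡p p)))
x∈p⇒∣p∣≡suc∣p-x∣ {p = inside  ∷ p} (there x∈p) = cong suc (x∈p⇒∣p∣≡suc∣p-x∣ x∈p)
x∈p⇒∣p∣≡suc∣p-x∣ {p = outside ∷ p} (there x∈p) = x∈p⇒∣p∣≡suc∣p-x∣ x∈p

x∈p∧k≤∣p-x∣⇒suc[k]≤∣p∣ : x ∈ p → k ≤ ∣ p - x ∣ → suc k ≤ ∣ p ∣
x∈p∧k≤∣p-x∣⇒suc[k]≤∣p∣ x∈p k≤ = subst (suc _ ≤_) (sym (x∈p⇒∣p∣≡suc∣p-x∣ x∈p)) (s≤s k≤)

x∈p∧suc[k]≤∣p∣⇒k≤∣p-x∣ : x ∈ p → suc k ≤ ∣ p ∣ → k ≤ ∣ p - x ∣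
x∈p∧suc[k]≤∣p∣⇒k≤∣p-x∣ x∈p 1+k≤ = s≤s⁻¹ (subst (suc _ ≤_) (x∈p⇒∣p∣≡suc∣p-x∣ x∈p) 1+k≤)

x∈p⇒1≤∣p∣ : x ∈ p → 1 ≤ ∣ p ∣
x∈p⇒1≤∣p∣ x∈p = x∈p∧k≤∣p-x∣⇒suc[k]≤∣p∣ x∈p z≤n

x∈p∧y∈p∧x≢y⇒2≤∣p∣ : x ∈ p → y ∈ p → x ≢ y → 2 ≤ ∣ p ∣
x∈p∧y∈p∧x≢y⇒2≤∣p∣ x∈p y∈p x≢y =
  x∈p∧k≤∣p-x∣⇒suc[k]≤∣p∣ x∈p (x∈p⇒1≤∣p∣ (x∈p∧x≢y⇒x∈p-y y∈p (x≢y ∘ sym)))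

∣p∣≡0⇒p≡⊥ : ∣ p ∣ ≡ 0 → p ≡ ⊥
∣p∣≡0⇒p≡⊥ ∣p∣≡0 = Empty-unique λ (_ , x∈p) →
  contradiction (subst (1 ≤_) ∣p∣≡0 (x∈p⇒1≤∣p∣ x∈p)) λ ()

x∈p─q⇒x∉q : x ∈ p ─ q → x ∉ q
x∈p─q⇒x∉q {p = _ ∷ p} {q = inside  ∷ q} (there x∈p─q) (there x∈q) = x∈p─q⇒x∉q x∈p─q x∈q
x∈p─q⇒x∉q {p = _ ∷ p} {q = outside ∷ q} (there x∈p─q) (there x∈q) = x∈p─q⇒x∉q x∈p─q x∈q

x∈p-y⇒x≢y : x ∈ p - y → x ≢ y
x∈p-y⇒x≢y x∈p-y = x∉⁅y⁆⇒x≢y (x∈p─q⇒x∉q x∈p-y)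

∣q∣<∣p∣⇒∃∈p∉q : ∣ q ∣ < ∣ p ∣ → ∃ λ x → x ∈ p × x ∉ q
∣q∣<∣p∣⇒∃∈p∉q {q = q} {p = p} ∣q∣<∣p∣ with any? (λ x → x ∈? p ×-dec ¬? (x ∈? q))
... | yes found = found
... | no none   = contradiction (p⊆q⇒∣p∣≤∣q∣ p⊆q) (<⇒≱ ∣q∣<∣p∣)
  where
  p⊆q : p ⊆ q
  p⊆q {x} x∈p = decidable-stable (x ∈? q) λ x∉q → none (x , x∈p , x∉q)

p⊆q∧∣q∣≤∣p∣⇒q⊆p : p ⊆ q → ∣ q ∣ ≤ ∣ p ∣ → q ⊆ p
p⊆q∧∣q∣≤∣p∣⇒q⊆p {p = p} p⊆q ∣q∣≤∣p∣ {x} x∈q =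
  decidable-stable (x ∈? p) λ x∉p → <⇒≱ (p⊂q⇒∣p∣<∣q∣ (p⊆q , x , x∈q , x∉p)) ∣q∣≤∣p∣

1≤∣p∣⇒Nonempty : 1 ≤ ∣ p ∣ → Nonempty p
1≤∣p∣⇒Nonempty {n} {p} 1≤∣p∣ with ∣q∣<∣p∣⇒∃∈p∉q {q = ⊥} {p} (subst (_< ∣ p ∣) (sym (∣⊥∣≡0 n)) 1≤∣p∣)
... | x , x∈p , _ = x , x∈p

2≤∣p∣⇒∃≢ : 2 ≤ ∣ p ∣ → ∀ x → ∃ λ y → y ∈ p × y ≢ x
2≤∣p∣⇒∃≢ {p = p} 2≤∣p∣ x with ∣q∣<∣p∣⇒∃∈p∉q {q = ⁅ x ⁆} (subst (_< ∣ p ∣) (sym (∣⁅x⁆∣≡1 x)) 2≤∣p∣)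
... | y , y∈p , y∉⁅x⁆ = y , y∈p , x∉⁅y⁆⇒x≢y y∉⁅x⁆

3≤∣p∣⇒∃≢≢ : 3 ≤ ∣ p ∣ → x ∈ p → ∀ y → ∃ λ z → z ∈ p × z ≢ x × z ≢ y
3≤∣p∣⇒∃≢≢ {p = p} {x} 3≤∣p∣ x∈p y with 2≤∣p∣⇒∃≢ {p = p - x} (x∈p∧suc[k]≤∣p∣⇒k≤∣p-x∣ x∈p 3≤∣p∣) y
... | z , z∈p-x , z≢y = z , p─q⊆p p ⁅ x ⁆ z∈p-x , x∈p-y⇒x≢y {p = p} z∈p-x , z≢y

x∈p∧y∈p∧z∈p⇒3≤∣p∣ : x ∈ p → y ∈ p → z ∈ p → x ≢ y → x ≢ z → y ≢ z → 3 ≤ ∣ p ∣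
x∈p∧y∈p∧z∈p⇒3≤∣p∣ x∈p y∈p z∈p x≢y x≢z y≢z =
  x∈p∧k≤∣p-x∣⇒suc[k]≤∣p∣ x∈p
    (x∈p∧y∈p∧x≢y⇒2≤∣p∣ (x∈p∧x≢y⇒x∈p-y y∈p (x≢y ∘ sym)) (x∈p∧x≢y⇒x∈p-y z∈p (x≢z ∘ sym)) y≢z)

∣p∣≤2⇒∈⁻ : ∀ {a b} → ∣ p ∣ ≤ 2 → a ∈ p → b ∈ p → a ≢ b → x ∈ p → x ≡ a ⊎ x ≡ b
∣p∣≤2⇒∈⁻ {x = x} {a} {b} ∣p∣≤2 a∈p b∈p a≢b x∈p with x ≟ a | x ≟ b
... | yes x≡a | _       = inj₁ x≡a
... | no _    | yes x≡b = inj₂ x≡b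
... | no x≢a  | no x≢b  =
  contradiction ∣p∣≤2 (<⇒≱ (x∈p∧y∈p∧z∈p⇒3≤∣p∣ a∈p b∈p x∈p a≢b (x≢a ∘ sym) (x≢b ∘ sym)))

∣p∣≤3⇒∈⁻ : ∀ {a b c} → ∣ p ∣ ≤ 3 → a ∈ p → b ∈ p → c ∈ p → a ≢ b → a ≢ c → b ≢ c →
           x ∈ p → x ≡ a ⊎ x ≡ b ⊎ x ≡ c
∣p∣≤3⇒∈⁻ {p = p} {x} {a} {b} {c} ∣p∣≤3 a∈p b∈p c∈p a≢b a≢c b≢c x∈p with x ≟ a | x ≟ b | x ≟ c
... | yes x≡a | _       | _       = inj₁ x≡a
... | no _    | yes x≡b | _       = inj₂ (inj₁ x≡b)
... | no _    | no _    | yes x≡c = inj₂ (inj₂ x≡c)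
... | no x≢a  | no x≢b  | no x≢c  = contradiction ∣p∣≤3 (<⇒≱ 4≤∣p∣)
  where
  -∈ : ∀ {y} → y ∈ p → y ≢ x → y ∈ p - x
  -∈ = x∈p∧x≢y⇒x∈p-y
  4≤∣p∣ : 4 ≤ ∣ p ∣
  4≤∣p∣ = x∈p∧k≤∣p-x∣⇒suc[k]≤∣p∣ x∈p
    (x∈p∧y∈p∧z∈p⇒3≤∣p∣ (-∈ a∈p (x≢a ∘ sym)) (-∈ b∈p (x≢b ∘ sym)) (-∈ c∈p (x≢c ∘ sym)) a≢b a≢c b≢c)

pair : Fin n → Fin n → Subset n
pair x y = ⁅ x ⁆ ∪ ⁅ y ⁆

x∈pair : x ∈ pair x y
x∈pair {x = x} = x∈p∪q⁺ (inj₁ (x∈⁅x⁆ x))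

y∈pair : y ∈ pair x y
y∈pair {y = y} = x∈p∪q⁺ (inj₂ (x∈⁅x⁆ y))

∈pair⁻ : ∀ {z} → z ∈ pair x y → z ≡ x ⊎ z ≡ y
∈pair⁻ {x = x} {y} z∈pair with x∈p∪q⁻ ⁅ x ⁆ ⁅ y ⁆ z∈pair
... | inj₁ z∈⁅x⁆ = inj₁ (x∈⁅y⁆⇒x≡y x z∈⁅x⁆)
... | inj₂ z∈⁅y⁆ = inj₂ (x∈⁅y⁆⇒x≡y y z∈⁅y⁆)

∣pair∣≤2 : ∀ (x y : Fin n) → ∣ pair x y ∣ ≤ 2
∣pair∣≤2 x y =
  subst (_≤ 2) (sym (x∈p⇒∣p∣≡suc∣p-x∣ {p = pair x y} x∈pair))
    (s≤s (subst (∣ pair x y - x ∣ ≤_) (∣⁅x⁆∣≡1 y) (p⊆q⇒∣p∣≤∣q∣ pair-x⊆⁅y⁆)))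
  where
  pair-x⊆⁅y⁆ : pair x y - x ⊆ ⁅ y ⁆
  pair-x⊆⁅y⁆ z∈pair-x with ∈pair⁻ (p─q⊆p (pair x y) ⁅ x ⁆ z∈pair-x)
  ... | inj₁ z≡x  = contradiction z≡x (x∈p-y⇒x≢y {p = pair x y} z∈pair-x)
  ... | inj₂ refl = x∈⁅x⁆ y

bool-pigeonhole : (a b c : Bool) → a ≡ b ⊎ b ≡ c ⊎ c ≡ a
bool-pigeonhole false false _     = inj₁ refl
bool-pigeonhole true  true  _     = inj₁ refl
bool-pigeonhole false true  false = inj₂ (inj₂ refl)
bool-pigeonhole false true  true  = inj₂ (inj₁ refl)
bool-pigeonhole true  false false = inj₂ (inj₁ refl)
bool-pigeonhole true  false true  = inj₂ (inj₂ refl)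

module _ {n : ℕ} (G : Graph n) where

  private variable
    M N M' C C' : Subset n
    u v w : Fin n
    b : Bool

  E : Fin n → Fin n → Bool
  E = adj G

  E-sym : ∀ x y → E x y ≡ E y x
  E-sym = Graph.sym G

  isModule⁺ : (∀ x → x ∉ M → ∀ u v → u ∈ M → v ∈ M → E x u ≡ E x v) → IsModule G M
  isModule⁺ sees-alike = (λ _ → ∈⊤) , λ x _ → sees-alike x

  isModule⁻ : IsModule G M → x ∉ M → u ∈ M → v ∈ M → E x u ≡ E x v
  isModule⁻ (_ , sees-alike) x∉M = sees-alike _ ∈⊤ x∉M _ _

  isModule⇒isModuleIn : IsModule G N → N ⊆ M → IsModuleIn G M N
  isModule⇒isModuleIn N-mod N⊆M = N⊆M , λ _ _ x∉N _ _ → isModule⁻ N-mod x∉N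

  isModuleIn⇒isModule : IsModule G M → IsModuleIn G M N → IsModule G N
  isModuleIn⇒isModule {M = M} {N = N} M-mod (N⊆M , N-modIn) = isModule⁺ sees-alike
    where
    sees-alike : ∀ x → x ∉ N → ∀ u v → u ∈ N → v ∈ N → E x u ≡ E x v
    sees-alike x x∉N u v u∈N v∈N with x ∈? M
    ... | yes x∈M = N-modIn x x∈M x∉N u v u∈N v∈N
    ... | no x∉M  = isModule⁻ M-mod x∉M (N⊆M u∈N) (N⊆M v∈N)

  ∩-isModule : IsModule G M → IsModule G M' → IsModule G (M ∩ M')
  ∩-isModule {M} {M'} M-mod M'-mod = isModule⁺ sees-alike
    where
    sees-alike : ∀ x → x ∉ M ∩ M' → ∀ u v → u ∈ M ∩ M' → v ∈ M ∩ M' → E x u ≡ E x v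
    sees-alike x x∉M∩M' u v u∈M∩M' v∈M∩M' with x ∈? M | x ∈? M'
    ... | no x∉M  | _        = isModule⁻ M-mod x∉M (p∩q⊆p M M' u∈M∩M') (p∩q⊆p M M' v∈M∩M')
    ... | yes _   | no x∉M'  = isModule⁻ M'-mod x∉M' (p∩q⊆q M M' u∈M∩M') (p∩q⊆q M M' v∈M∩M')
    ... | yes x∈M | yes x∈M' = contradiction (x∈p∩q⁺ (x∈M , x∈M')) x∉M∩M'

  -- For x ∈ M ∩ M' the chain passes through w ∈ M' ∖ M: the vertices y, z ∉ M'
  -- do not distinguish x from w, and w ∉ M does not distinguish y from z.
  ─-isModule : IsModule G M → IsModule G M' → w ∈ M' → w ∉ M → IsModule G (M ─ M')
  ─-isModule {M} {M'} {w} M-mod M'-mod w∈M' w∉M = isModule⁺ sees-alike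
    where
    sees-alike : ∀ x → x ∉ M ─ M' → ∀ y z → y ∈ M ─ M' → z ∈ M ─ M' → E x y ≡ E x z
    sees-alike x x∉M─M' y z y∈M─M' z∈M─M' with x ∈? M | x ∈? M'
    ... | no x∉M  | _        = isModule⁻ M-mod x∉M (p─q⊆p M M' y∈M─M') (p─q⊆p M M' z∈M─M')
    ... | yes x∈M | no x∉M'  = contradiction (x∈p∧x∉q⇒x∈p─q x∈M x∉M') x∉M─M'
    ... | yes _   | yes x∈M' = begin
      E x y  ≡⟨ E-sym x y ⟩
      E y x  ≡⟨ isModule⁻ M'-mod (x∈p─q⇒x∉q y∈M─M') x∈M' w∈M' ⟩
      E y w  ≡⟨ E-sym y w ⟩
      E w y  ≡⟨ isModule⁻ M-mod w∉M (p─q⊆p M M' y∈M─M') (p─q⊆p M M' z∈M─M') ⟩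
      E w z  ≡⟨ E-sym w z ⟩
      E z w  ≡⟨ isModule⁻ M'-mod (x∈p─q⇒x∉q z∈M─M') x∈M' w∈M' ⟨
      E z x  ≡⟨ E-sym z x ⟩
      E x z  ∎
      where open ≡-Reasoning

  Twins : Fin n → Fin n → Set
  Twins u v = ∀ x → x ≢ u → x ≢ v → E x u ≡ E x v

  twins-refl : Twins u u
  twins-refl _ _ _ = refl

  twins? : ∀ u v → Dec (Twins u v)
  twins? u v = all? λ x → ¬? (x ≟ u) →-dec ¬? (x ≟ v) →-dec (E x u ≟ᵇ E x v)

  module⇒twins : IsModule G M → u ∈ M → v ∈ M →
                 (∀ x → x ∈ M → x ≢ u → x ≢ v → E x u ≡ E x v) → Twins u v
  module⇒twins {M = M} M-mod u∈M v∈M twins-inside x x≢u x≢v with x ∈? M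
  ... | yes x∈M = twins-inside x x∈M x≢u x≢v
  ... | no x∉M  = isModule⁻ M-mod x∉M u∈M v∈M

  ∣∣≤2-module⇒twins : IsModule G M → ∣ M ∣ ≤ 2 → u ∈ M → v ∈ M → Twins u v
  ∣∣≤2-module⇒twins {u = u} {v} M-mod ∣M∣≤2 u∈M v∈M with u ≟ v
  ... | yes refl = twins-refl
  ... | no u≢v   = module⇒twins M-mod u∈M v∈M λ x x∈M x≢u x≢v →
    [ (λ x≡u → contradiction x≡u x≢u) , (λ x≡v → contradiction x≡v x≢v) ]
      (∣p∣≤2⇒∈⁻ ∣M∣≤2 u∈M v∈M u≢v x∈M)

  twins⇒pair-isModule : Twins u v → IsModule G (pair u v)
  twins⇒pair-isModule {u} {v} u~v = isModule⁺ sees-alike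
    where
    outside-sees-alike : ∀ x → x ∉ pair u v → E x u ≡ E x v
    outside-sees-alike x x∉pair = u~v x (λ { refl → x∉pair x∈pair }) (λ { refl → x∉pair y∈pair })
    sees-alike : ∀ x → x ∉ pair u v → ∀ s t → s ∈ pair u v → t ∈ pair u v → E x s ≡ E x t
    sees-alike x x∉pair s t s∈pair t∈pair with ∈pair⁻ s∈pair | ∈pair⁻ t∈pair
    ... | inj₁ refl | inj₁ refl = refl
    ... | inj₁ refl | inj₂ refl = outside-sees-alike x x∉pair
    ... | inj₂ refl | inj₁ refl = sym (outside-sees-alike x x∉pair)
    ... | inj₂ refl | inj₂ refl = refl

  twinsOf : Fin n → Subset n
  twinsOf u = tabulate λ v → does (twins? u v)

  twins⇒∈twinsOf : Twins u v → v ∈ twinsOf u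
  twins⇒∈twinsOf {u} {v} u~v =
    lookup⇒[]= v (twinsOf u) (trans (lookup∘tabulate _ v) (dec-true (twins? u v) u~v))

  ∈twinsOf⇒twins : v ∈ twinsOf u → Twins u v
  ∈twinsOf⇒twins {v} {u} v∈twinsOf = decidable-stable (twins? u v) λ ¬u~v →
    contradiction (trans (sym (dec-false (twins? u v) ¬u~v))
                         (trans (sym (lookup∘tabulate _ v)) ([]=⇒lookup v∈twinsOf)))
                  λ ()

  twins⇒pair-minimal : u ≢ v → Twins u v → InMmin G (pair u v)
  twins⇒pair-minimal {u} {v} u≢v u~v =
    (twins⇒pair-isModule u~v , x∈p∧y∈p∧x≢y⇒2≤∣p∣ {p = pair u v} x∈pair y∈pair u≢v) ,
    λ M (_ , 2≤∣M∣) M⊆pair →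
      ⊆-antisym M⊆pair (p⊆q∧∣q∣≤∣p∣⇒q⊆p M⊆pair (≤-trans (∣pair∣≤2 u v) 2≤∣M∣))

  minimal-∩ : InMmin G M → InMmin G M' → 2 ≤ ∣ M ∩ M' ∣ → M ≡ M'
  minimal-∩ {M} {M'} M-min M'-min 2≤∣M∩M'∣ =
    trans (sym (proj₂ M-min (M ∩ M') M∩M'∈𝓜 (p∩q⊆p M M')))
          (proj₂ M'-min (M ∩ M') M∩M'∈𝓜 (p∩q⊆q M M'))
    where
    M∩M'∈𝓜 : InM G (M ∩ M')
    M∩M'∈𝓜 = ∩-isModule (proj₁ (proj₁ M-min)) (proj₁ (proj₁ M'-min)) , 2≤∣M∩M'∣

  minimal-meeting-in-one-vertex : InMmin G M → InM G M' → u ∈ M → u ∈ M' →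
                                  (∀ y → y ∈ M → y ∈ M' → y ≡ u) → ∣ M ∣ ≡ 2
  minimal-meeting-in-one-vertex {M} {M'} {u} M-min (M'-mod , 2≤∣M'∣) u∈M u∈M' meet-in-u
    with ∣ M ∣ ≟ℕ 2 | 2≤∣p∣⇒∃≢ 2≤∣M'∣ u
  ... | yes ∣M∣≡2 | _              = ∣M∣≡2
  ... | no ∣M∣≢2  | w , w∈M' , w≢u =
    ⊥-elim (<-irrefl (cong ∣_∣ M─M'≡M) (p∩q≢∅⇒∣p─q∣<∣p∣ M M' (u , x∈p∩q⁺ (u∈M , u∈M'))))
    where
    M-u⊆M─M' : M - u ⊆ M ─ M'
    M-u⊆M─M' {y} y∈M-u = x∈p∧x∉q⇒x∈p─q y∈M
      λ y∈M' → x∈p-y⇒x≢y {p = M} y∈M-u (meet-in-u y y∈M y∈M')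
      where y∈M = p─q⊆p M ⁅ u ⁆ y∈M-u
    2≤∣M─M'∣ : 2 ≤ ∣ M ─ M' ∣
    2≤∣M─M'∣ = ≤-trans
      (x∈p∧suc[k]≤∣p∣⇒k≤∣p-x∣ u∈M (≤∧≢⇒< (proj₂ (proj₁ M-min)) (∣M∣≢2 ∘ sym)))
      (p⊆q⇒∣p∣≤∣q∣ M-u⊆M─M')
    M─M'≡M : M ─ M' ≡ M
    M─M'≡M = proj₂ M-min (M ─ M')
      (─-isModule (proj₁ (proj₁ M-min)) M'-mod w∈M' (λ w∈M → w≢u (meet-in-u w w∈M w∈M'))
        , 2≤∣M─M'∣)
      (p─q⊆p M M')

  minimal-overlap : InMmin G M → InMmin G M' → u ∈ M → u ∈ M' → M ≡ M' ⊎ ∣ M ∣ ≡ 2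
  minimal-overlap {M} {M'} {u} M-min M'-min u∈M u∈M'
    with any? (λ y → y ∈? M ∩ M' ×-dec ¬? (y ≟ u))
  ... | yes (y , y∈M∩M' , y≢u) =
    inj₁ (minimal-∩ M-min M'-min (x∈p∧y∈p∧x≢y⇒2≤∣p∣ y∈M∩M' (x∈p∩q⁺ (u∈M , u∈M')) y≢u))
  ... | no ∄ = inj₂ (minimal-meeting-in-one-vertex M-min (proj₁ M'-min) u∈M u∈M' λ y y∈M y∈M' →
    decidable-stable (y ≟ u) λ y≢u → ∄ (y , x∈p∩q⁺ (y∈M , y∈M') , y≢u))

  minimal-∣∣≤3⇒distinguishes : InMmin G M → ∣ M ∣ ≤ 3 → u ∈ M → v ∈ M → w ∈ M →
                               u ≢ v → u ≢ w → v ≢ w → E u v ≢ E u w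
  minimal-∣∣≤3⇒distinguishes {M} {u} {v} {w} M-min ∣M∣≤3 u∈M v∈M w∈M u≢v u≢w v≢w Euv≡Euw =
    [ u≢v , u≢w ] (∈pair⁻ (subst (u ∈_) (sym pair≡M) u∈M))
    where
    alike-inside : ∀ x → x ∈ M → x ≢ v → x ≢ w → E x v ≡ E x w
    alike-inside x x∈M x≢v x≢w with ∣p∣≤3⇒∈⁻ ∣M∣≤3 u∈M v∈M w∈M u≢v u≢w v≢w x∈M
    ... | inj₁ refl        = Euv≡Euw
    ... | inj₂ (inj₁ x≡v) = contradiction x≡v x≢v
    ... | inj₂ (inj₂ x≡w) = contradiction x≡w x≢w
    pair⊆M : pair v w ⊆ M
    pair⊆M s∈pair with ∈pair⁻ s∈pair
    ... | inj₁ refl = v∈M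
    ... | inj₂ refl = w∈M
    pair≡M : pair v w ≡ M
    pair≡M = proj₂ M-min (pair v w)
      (proj₁ (twins⇒pair-minimal v≢w (module⇒twins (proj₁ (proj₁ M-min)) v∈M w∈M alike-inside)))
      pair⊆M

  minimal-∣∣≢3 : InMmin G M → ∣ M ∣ ≢ 3
  minimal-∣∣≢3 {M} M-min@(( _ , 2≤∣M∣) , _) ∣M∣≡3
    with 1≤∣p∣⇒Nonempty (≤-trans (s≤s z≤n) 2≤∣M∣)
  ... | a , a∈M with 2≤∣p∣⇒∃≢ 2≤∣M∣ a
  ... | b , b∈M , b≢a with 3≤∣p∣⇒∃≢≢ (≤-reflexive (sym ∣M∣≡3)) a∈M b
  ... | c , c∈M , c≢a , c≢b with bool-pigeonhole (E a b) (E b c) (E c a)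
  ... | inj₁ Eab≡Ebc = minimal-∣∣≤3⇒distinguishes M-min (≤-reflexive ∣M∣≡3)
    b∈M a∈M c∈M b≢a (c≢b ∘ sym) (c≢a ∘ sym) (trans (E-sym b a) Eab≡Ebc)
  ... | inj₂ (inj₁ Ebc≡Eca) = minimal-∣∣≤3⇒distinguishes M-min (≤-reflexive ∣M∣≡3)
    c∈M b∈M a∈M c≢b c≢a b≢a (trans (E-sym c b) Ebc≡Eca)
  ... | inj₂ (inj₂ Eca≡Eab) = minimal-∣∣≤3⇒distinguishes M-min (≤-reflexive ∣M∣≡3)
    a∈M c∈M b∈M (c≢a ∘ sym) (b≢a ∘ sym) c≢b (trans (E-sym a c) Eca≡Eab)

  minimal⇒primeOn : InMmin G M → ∣ M ∣ ≢ 2 → PrimeOn G M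
  minimal⇒primeOn {M} M-min@((M-mod , 2≤∣M∣) , minimality) ∣M∣≢2 =
    ≤∧≢⇒< (≤∧≢⇒< 2≤∣M∣ (∣M∣≢2 ∘ sym)) (minimal-∣∣≢3 M-min ∘ sym) , trivial
    where
    trivial : ∀ N → IsModuleIn G M N → TrivialIn G M N
    trivial N N-modIn with ∣ N ∣ in ∣N∣≡k
    ... | 0           = inj₁ (∣p∣≡0⇒p≡⊥ ∣N∣≡k)
    ... | 1           = inj₂ (inj₂ refl)
    ... | suc (suc _) = inj₂ (inj₁ (minimality N
      (isModuleIn⇒isModule M-mod N-modIn , subst (2 ≤_) (sym ∣N∣≡k) (s≤s (s≤s z≤n)))
      (proj₁ N-modIn)))

  primeModule⇒minimal : InP G M → InMmin G M
  primeModule⇒minimal {M} (M-mod , 4≤∣M∣ , trivial) =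
    (M-mod , ≤-trans (s≤s (s≤s z≤n)) 4≤∣M∣) , minimality
    where
    minimality : ∀ N → InM G N → N ⊆ M → N ≡ M
    minimality N (N-mod , 2≤∣N∣) N⊆M with trivial N (isModule⇒isModuleIn N-mod N⊆M)
    ... | inj₁ refl         = contradiction (subst (2 ≤_) (∣⊥∣≡0 n) 2≤∣N∣) λ ()
    ... | inj₂ (inj₁ N≡M)   = N≡M
    ... | inj₂ (inj₂ ∣N∣≡1) = contradiction (subst (2 ≤_) ∣N∣≡1 2≤∣N∣) λ { (s≤s ()) }

  Uniform : Bool → Subset n → Set
  Uniform b M = ∀ u v → u ∈ M → v ∈ M → u ≢ v → E u v ≡ b

  uniform-module⇒twins : IsModule G M → Uniform b M → u ∈ M → v ∈ M → Twins u v
  uniform-module⇒twins {u = u} {v} M-mod M-unif u∈M v∈M =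
    module⇒twins M-mod u∈M v∈M λ x x∈M x≢u x≢v →
      trans (M-unif x u x∈M u∈M x≢u) (sym (M-unif x v x∈M v∈M x≢v))

  twinsOf-isModule : IsModule G (twinsOf u)
  twinsOf-isModule {u} = isModule⁺ λ x x∉T y z y∈T z∈T →
    trans (sees-as-u x x∉T y∈T) (sym (sees-as-u x x∉T z∈T))
    where
    sees-as-u : ∀ x → x ∉ twinsOf u → ∀ {y} → y ∈ twinsOf u → E x y ≡ E x u
    sees-as-u x x∉T y∈T = sym (∈twinsOf⇒twins y∈T x
      (λ { refl → x∉T (twins⇒∈twinsOf twins-refl) }) (λ { refl → x∉T y∈T }))

  twins⇒E-centre : Twins u y → Twins u z → y ≢ u → z ≢ u → E u y ≡ E u z
  twins⇒E-centre {u} {y} {z} u~y u~z y≢u z≢u with y ≟ z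
  ... | yes refl = refl
  ... | no y≢z   = begin
    E u y  ≡⟨ E-sym u y ⟩
    E y u  ≡⟨ u~z y y≢u y≢z ⟩
    E y z  ≡⟨ E-sym y z ⟩
    E z y  ≡⟨ u~y z z≢u (y≢z ∘ sym) ⟨
    E z u  ≡⟨ E-sym z u ⟩
    E u z  ∎
    where open ≡-Reasoning

  twinsOf-uniform : v ≢ u → Twins u v → Uniform (E u v) (twinsOf u)
  twinsOf-uniform {v} {u} v≢u u~v = uniform
    where
    E-centre : ∀ {t} → t ∈ twinsOf u → t ≢ u → E u t ≡ E u v
    E-centre t∈T t≢u = twins⇒E-centre (∈twinsOf⇒twins t∈T) u~v t≢u v≢u
    uniform : Uniform (E u v) (twinsOf u)
    uniform y z y∈T z∈T y≢z with y ≟ u | z ≟ u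
    ... | yes refl | _        = E-centre z∈T (y≢z ∘ sym)
    ... | no y≢u   | yes refl = trans (E-sym y u) (E-centre y∈T y≢u)
    ... | no y≢u   | no z≢u   =
      trans (sym (∈twinsOf⇒twins z∈T y y≢u y≢z)) (trans (E-sym y u) (E-centre y∈T y≢u))

  MaximalUniform : Bool → Subset n → Set
  MaximalUniform b C = (InM G C × Uniform b C) × (∀ M → InM G M → Uniform b M → C ⊆ M → M ≡ C)

  stable⇒uniform : IsStable G M → Uniform false M
  stable⇒uniform M-stable u v u∈M v∈M _ = M-stable u v u∈M v∈M

  uniform⇒stable : Uniform false M → IsStable G M
  uniform⇒stable M-unif u v u∈M v∈M with u ≟ v
  ... | yes refl = irrefl G u
  ... | no u≢v   = M-unif u v u∈M v∈M u≢v

  maximalUniform⇒InC⊎InS : MaximalUniform b C → InC G C ⊎ InS G C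
  maximalUniform⇒InC⊎InS {true}  C-max = inj₁ C-max
  maximalUniform⇒InC⊎InS {false} ((C∈𝓜 , C-unif) , maximal) =
    inj₂ ((C∈𝓜 , uniform⇒stable C-unif) ,
          λ M M∈𝓜 M-stable → maximal M M∈𝓜 (stable⇒uniform M-stable))

  InS⇒maximalUniform : InS G C → MaximalUniform false C
  InS⇒maximalUniform ((C∈𝓜 , C-stable) , maximal) =
    (C∈𝓜 , stable⇒uniform C-stable) , λ M M∈𝓜 M-unif → maximal M M∈𝓜 (uniform⇒stable M-unif)

  twinsOf-maximalUniform : v ≢ u → Twins u v → MaximalUniform (E u v) (twinsOf u)
  twinsOf-maximalUniform {v} {u} v≢u u~v =
    ((twinsOf-isModule , x∈p∧y∈p∧x≢y⇒2≤∣p∣ (twins⇒∈twinsOf u~v) u∈T v≢u) ,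
     twinsOf-uniform v≢u u~v) ,
    λ M (M-mod , _) M-unif T⊆M → ⊆-antisym
      (λ y∈M → twins⇒∈twinsOf (uniform-module⇒twins M-mod M-unif (T⊆M u∈T) y∈M)) T⊆M
    where
    u∈T : u ∈ twinsOf u
    u∈T = twins⇒∈twinsOf twins-refl

  maximalUniform⇒≡twinsOf : MaximalUniform b C → u ∈ C → C ≡ twinsOf u
  maximalUniform⇒≡twinsOf {b} {C} {u} (((C-mod , 2≤∣C∣) , C-unif) , maximal) u∈C
    with 2≤∣p∣⇒∃≢ 2≤∣C∣ u
  ... | v , v∈C , v≢u = sym (maximal (twinsOf u) T∈𝓜 T-unif C⊆T)
    where
    C⊆T : C ⊆ twinsOf u
    C⊆T y∈C = twins⇒∈twinsOf (uniform-module⇒twins C-mod C-unif u∈C y∈C)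
    T∈𝓜 : InM G (twinsOf u)
    T∈𝓜 = twinsOf-isModule , ≤-trans 2≤∣C∣ (p⊆q⇒∣p∣≤∣q∣ C⊆T)
    T-unif : Uniform b (twinsOf u)
    T-unif = subst (λ b′ → Uniform b′ (twinsOf u)) (C-unif u v u∈C v∈C (v≢u ∘ sym))
                   (twinsOf-uniform v≢u (∈twinsOf⇒twins (C⊆T v∈C)))

  IsClassOf : Fin n → Subset n → Set
  IsClassOf u C = ∀ v → (v ∈ C → Approx G u v) × (Approx G u v → v ∈ C)

  isClassOf-unique : IsClassOf u C → IsClassOf u C' → C ≡ C'
  isClassOf-unique C-class C'-class = ⊆-antisym
    (λ {v} v∈C → proj₂ (C'-class v) (proj₁ (C-class v) v∈C))
    (λ {v} v∈C' → proj₂ (C-class v) (proj₁ (C'-class v) v∈C'))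

  minimal-isClassOf : InMmin G M → u ∈ M → ∣ M ∣ ≢ 2 → IsClassOf u M
  minimal-isClassOf {M} {u} M-min u∈M ∣M∣≢2 y =
    (λ y∈M → inj₂ (M , M-min , u∈M , y∈M)) , approx⇒∈
    where
    approx⇒∈ : Approx G u y → y ∈ M
    approx⇒∈ (inj₁ refl) = u∈M
    approx⇒∈ (inj₂ (M' , M'-min , u∈M' , y∈M')) with minimal-overlap M-min M'-min u∈M u∈M'
    ... | inj₁ M≡M'  = subst (y ∈_) (sym M≡M') y∈M'
    ... | inj₂ ∣M∣≡2 = contradiction ∣M∣≡2 ∣M∣≢2

  twinsOf-isClassOf : v ≢ u → Twins u v → IsClassOf u (twinsOf u)
  twinsOf-isClassOf {v} {u} v≢u u~v y = ∈⇒approx , approx⇒∈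
    where
    ∈⇒approx : y ∈ twinsOf u → Approx G u y
    ∈⇒approx y∈T with u ≟ y
    ... | yes u≡y = inj₁ u≡y
    ... | no u≢y  =
      inj₂ (pair u y , twins⇒pair-minimal u≢y (∈twinsOf⇒twins y∈T) , x∈pair , y∈pair)
    approx⇒∈ : Approx G u y → y ∈ twinsOf u
    approx⇒∈ (inj₁ refl) = twins⇒∈twinsOf twins-refl
    approx⇒∈ (inj₂ (M , M-min , u∈M , y∈M)) =
      twins⇒∈twinsOf (∣∣≤2-module⇒twins (proj₁ (proj₁ M-min)) ∣M∣≤2 u∈M y∈M)
      where
      ∣M∣≤2 : ∣ M ∣ ≤ 2
      ∣M∣≤2 with minimal-overlap M-min (twins⇒pair-minimal (v≢u ∘ sym) u~v) u∈M x∈pair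
      ... | inj₁ M≡pair = subst (_≤ 2) (sym (cong ∣_∣ M≡pair)) (∣pair∣≤2 u v)
      ... | inj₂ ∣M∣≡2  = ≤-reflexive ∣M∣≡2

  class⇒InC⊎InS⊎InP : IsClassOf u C → 2 ≤ ∣ C ∣ → InC G C ⊎ InS G C ⊎ InP G C
  class⇒InC⊎InS⊎InP {u} {C} C-class 2≤∣C∣ with 2≤∣p∣⇒∃≢ 2≤∣C∣ u
  ... | v , v∈C , v≢u with proj₁ (C-class v) v∈C
  ... | inj₁ u≡v = contradiction (sym u≡v) v≢u
  ... | inj₂ (M , M-min , u∈M , v∈M) with ∣ M ∣ ≟ℕ 2
  ... | yes ∣M∣≡2 = [ inj₁ , inj₂ ∘ inj₁ ] (subst (λ D → InC G D ⊎ InS G D) (sym C≡T)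
                      (maximalUniform⇒InC⊎InS (twinsOf-maximalUniform v≢u u~v)))
    where
    u~v : Twins u v
    u~v = ∣∣≤2-module⇒twins (proj₁ (proj₁ M-min)) (≤-reflexive ∣M∣≡2) u∈M v∈M
    C≡T : C ≡ twinsOf u
    C≡T = isClassOf-unique C-class (twinsOf-isClassOf v≢u u~v)
  ... | no ∣M∣≢2 =
    inj₂ (inj₂ (subst (InP G) (sym C≡M) (proj₁ (proj₁ M-min) , minimal⇒primeOn M-min ∣M∣≢2)))
    where
    C≡M : C ≡ M
    C≡M = isClassOf-unique C-class (minimal-isClassOf M-min u∈M ∣M∣≢2)

  maximalUniform⇒class : MaximalUniform b C → InFrakM G C
  maximalUniform⇒class {C = C} C-max@(((_ , 2≤∣C∣) , _) , _)
    with 1≤∣p∣⇒Nonempty (≤-trans (s≤s z≤n) 2≤∣C∣)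
  ... | u , u∈C with 2≤∣p∣⇒∃≢ 2≤∣C∣ u
  ... | v , v∈C , v≢u = u , subst (IsClassOf u) (sym C≡T) (twinsOf-isClassOf v≢u u~v)
    where
    C≡T : C ≡ twinsOf u
    C≡T = maximalUniform⇒≡twinsOf C-max u∈C
    u~v : Twins u v
    u~v = ∈twinsOf⇒twins (subst (v ∈_) C≡T v∈C)

  primeModule⇒class : InP G C → InFrakM G C
  primeModule⇒class {C} C∈𝒫@(_ , 4≤∣C∣ , _) with 1≤∣p∣⇒Nonempty (≤-trans (s≤s z≤n) 4≤∣C∣)
  ... | u , u∈C = u , minimal-isClassOf (primeModule⇒minimal C∈𝒫) u∈C
    λ ∣C∣≡2 → contradiction (subst (4 ≤_) ∣C∣≡2 4≤∣C∣) λ { (s≤s (s≤s ())) }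

  InC⊎InS⊎InP⇒class : InC G C ⊎ InS G C ⊎ InP G C → InFrakM G C × 2 ≤ ∣ C ∣
  InC⊎InS⊎InP⇒class (inj₁ C∈𝒞@(((_ , 2≤∣C∣) , _) , _)) = maximalUniform⇒class C∈𝒞 , 2≤∣C∣
  InC⊎InS⊎InP⇒class (inj₂ (inj₁ C∈𝒮@(((_ , 2≤∣C∣) , _) , _))) =
    maximalUniform⇒class (InS⇒maximalUniform C∈𝒮) , 2≤∣C∣
  InC⊎InS⊎InP⇒class (inj₂ (inj₂ C∈𝒫@(_ , 4≤∣C∣ , _))) =
    primeModule⇒class C∈𝒫 , ≤-trans (s≤s (s≤s z≤n)) 4≤∣C∣

corollary13 : ∀ (n : ℕ) (G : Graph n) (C : Subset n) →
              ((InFrakM G C × 2 ≤ ∣ C ∣) → (InC G C ⊎ InS G C ⊎ InP G C)) ×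
              ((InC G C ⊎ InS G C ⊎ InP G C) → (InFrakM G C × 2 ≤ ∣ C ∣))
corollary13 n G C =
  (λ ((_ , C-class) , 2≤∣C∣) → class⇒InC⊎InS⊎InP G C-class 2≤∣C∣) , InC⊎InS⊎InP⇒class G
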